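{- The class of quasi-N4-lattices and the class of $\mathrm{Alg}^*(\mathbf{L}_{\mathrm{QN4}})$-algebras coincide: an algebra $\mathbf{A}=\langle A;\land,\lor,\to,\sim\rangle$ of type $\langle2,2,2,1\rangle$ is a QN4-lattice if and only if it is an $\mathrm{Alg}^*(\mathbf{L}_{\mathrm{QN4}})$-algebra.
   Context: Formulas/terms are built from variables using unary $\sim$ and binary $\land,\lor,\to$; $\alpha\leftrightarrow\beta:=(\alpha\to\beta)\land(\beta\to\alpha)$. The axiom schemes of the Hilbert calculus $\mathbf{L}_{\mathrm{QN4}}$ (with sole rule modus ponens) are: Ax1 $\alpha\to(\beta\to\alpha)$; Ax2 $(\alpha\to(\beta\to\gamma))\to((\alpha\to\beta)\to(\alpha\to\gamma))$; Ax3 $(\alpha\land\beta)\to\alpha$; Ax4 $(\alpha\land\beta)\to\beta$; Ax5 $(\alpha\to\beta)\to((\alpha\to\gamma)\to(\alpha\to(\beta\land\gamma)))$; Ax6 $\alpha\to(\alpha\lor\beta)$; Ax7 $\beta\to(\alpha\lor\beta)$; Ax8 $(\alpha\to\gamma)\to((\beta\to\gamma)\to((\alpha\lor\beta)\to\gamma))$; Ax9 $\sim(\alpha\lor\beta)\leftrightarrow(\sim\alpha\land\sim\beta)$; Ax10 $\sim(\alpha\to\beta)\leftrightarrow\sim\sim(\alpha\land\sim\beta)$; Ax11 $\sim(\alpha\land(\beta\land\gamma))\leftrightarrow\sim((\alpha\land\beta)\land\gamma)$; Ax12 $\sim(\alpha\land(\beta\lor\gamma))\leftrightarrow\sim((\alpha\land\beta)\lor(\alpha\land\gamma))$;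 Ax13 $\sim(\alpha\lor(\beta\land\gamma))\leftrightarrow\sim((\alpha\lor\beta)\land(\alpha\lor\gamma))$; Ax14 $\sim\sim(\alpha\land\beta)\leftrightarrow(\sim\sim\alpha\land\sim\sim\beta)$; Ax15 $\alpha\to\sim\sim\alpha$; Ax16 $\alpha\to(\sim\alpha\to\sim(\alpha\to\alpha))$; Ax17 $(\alpha\to\beta)\to(\sim\sim\alpha\to\sim\sim\beta)$; Ax18 $\sim\alpha\to\sim(\alpha\land\beta)$; Ax19 $\sim(\alpha\land\beta)\to\sim(\beta\land\alpha)$; Ax20 $(\sim\alpha\to\sim\beta)\to(\sim(\alpha\land\beta)\to\sim\beta)$; Ax21 $(\sim\alpha\to\sim\beta)\to((\sim\gamma\to\sim\theta)\to(\sim(\alpha\land\gamma)\to\sim(\beta\land\theta)))$; Ax22 $\sim\sim\sim\alpha\to\sim\alpha$. Let $E(\alpha)$ denote the equation $\alpha\approx\alpha\to\alpha$ and $\Delta(\alpha,\beta)=\{\alpha\to\beta,\beta\to\alpha,\sim\alpha\to\sim\beta,\sim\beta\to\sim\alpha\}$; $E(\Delta(\alpha,\beta))$ is the set of equations $E(\delta)$ for $\delta\in\Delta(\alpha,\beta)$. An $\mathrm{Alg}^*(\mathbf{L}_{\mathrm{QN4}})$-algebra is an algebra $\mathbf{A}=\langle A;\land,\lor,\to,\sim\rangle$ of type $\langle2,2,2,1\rangle$ satisfying: (1) $E(\varphi)$ for every instance $\varphi$ of Ax1–Ax22; (2) $E(\Delta(\alpha,\alpha))$; (3) the quasi-equation: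 $E(\Delta(\alpha,\beta))$ implies $\alpha\approx\beta$; (4) the quasi-equation: $E(\alpha)$ and $E(\alpha\to\beta)$ imply $E(\beta)$. In an algebra with a binary operation $\to$, write $|a|:=a\to a$, $a\preceq b$ iff $a\to b=|a\to b|$, and $a\equiv b$ iff $a\preceq b$ and $b\preceq a$. A Brouwerian algebra is a lattice $\langle B;\land,\lor\rangle$ with a binary operation $\to$ such that $a\land b\le c$ iff $a\le b\to c$. A nucleus on it is $\Box:B\to B$ with $\Box(a\land b)=\Box a\land\Box b$ and $a\le\Box a=\Box\Box a$. A quasi-N4-lattice (QN4-lattice) is an algebra $\mathbf{A}=\langle A;\land,\lor,\to,\sim\rangle$ of type $\langle2,2,2,1\rangle$ such that: (QN4a) $\langle A;\land,\lor\rangle$ is a distributive lattice with order $\le$; (QN4b) $\equiv$ is a congruence of $\langle A;\land,\lor,\to\rangle$, the quotient $\langle A;\land,\lor,\to\rangle/\!\equiv$ is a Brouwerian algebra, and $\Box[a]:=[\sim\sim a]$ is a nucleus on it; (QN4c) $a\le b$ iff $a\preceq b$ and $\sim b\preceq\sim a$; (QN4d) $\sim(a\to b)\equiv\sim\sim(a\land\sim b)$; (QN4e) $a\le\sim\sim a$, $\sim a=\sim\sim\sim a$, $\sim(a\lor b)=\sim a\land\sim b$, and $\sim\sim a\land\sim\sim b=\sim\sim(a\land b)$, for all $a,b\in A$. -}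

module Defs where

open import Level using (Level; _⊔_; suc)
open import Data.Product using (_×_; Σ)
open import Relation.Binary.PropositionalEquality using (_≡_)
open import Function.Bundles using (_⇔_)
import Algebra.Lattice.Structures as LS

record QAlgebra (ℓ : Level) : Set (suc ℓ) where
  infixr 5 _⇒_
  infixr 6 _∨_
  infixr 7 _∧_
  field
    Carrier : Set ℓ
    _∧_ _∨_ _⇒_ : Carrier → Carrier → Carrier
    ∼_ : Carrier → Carrier

  _⇔'_ : Carrier → Carrier → Carrier
  x ⇔' y = (x ⇒ y) ∧ (y ⇒ x)

  ∣_∣ : Carrier → Carrier
  ∣ x ∣ = x ⇒ x

  _≼_ : Carrier → Carrier → Set ℓ
  x ≼ y = (x ⇒ y) ≡ ∣ x ⇒ y ∣

  -- a ≣ b iff a ≼ b and b ≼ a   (the relation written ≡ in the paper)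
  _≣_ : Carrier → Carrier → Set ℓ
  x ≣ y = (x ≼ y) × (y ≼ x)

  _≤_ : Carrier → Carrier → Set ℓ
  x ≤ y = (x ∧ y) ≡ x

  -- order of the quotient lattice A/≣, expressed on representatives: [a] ≤ [b] iff [a ∧ b] = [a]
  _≤q_ : Carrier → Carrier → Set ℓ
  x ≤q y = (x ∧ y) ≣ x

  E : Carrier → Set ℓ
  E x = x ≡ (x ⇒ x)

  EΔ : Carrier → Carrier → Set ℓ
  EΔ x y = E (x ⇒ y) × E (y ⇒ x) × E ((∼ x) ⇒ (∼ y)) × E ((∼ y) ⇒ (∼ x))


record IsQN4Lattice {ℓ} (𝔸 : QAlgebra ℓ) : Set ℓ where
  open QAlgebra 𝔸
  field
    distributiveLattice : LS.IsDistributiveLattice (_≡_ {A = Carrier}) _∨_ _∧_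
    -- (QN4b) ≣ is a congruence of ⟨A; ∧, ∨, →⟩ and ⟨A; ∧, ∨⟩/≣ is a lattice
    -- (IsLattice for the setoid equality ≣ contains: ≣ is an equivalence,
    --  compatible with ∧ and ∨, and the lattice laws hold modulo ≣)
    quotientLattice : LS.IsLattice _≣_ _∨_ _∧_
    ⇒-cong : ∀ {a b c d} → a ≣ b → c ≣ d → (a ⇒ c) ≣ (b ⇒ d)
    --  the quotient is a Brouwerian algebra: [a] ∧ [b] ≤ [c] iff [a] ≤ [b] → [c]
    residuation : ∀ a b c → ((a ∧ b) ≤q c ⇔ a ≤q (b ⇒ c))
    --  □[a] := [∼∼a] is well defined and a nucleus on the quotient
    □-welldef : ∀ {a b} → a ≣ b → (∼ ∼ a) ≣ (∼ ∼ b)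
    □-∧ : ∀ a b → (∼ ∼ (a ∧ b)) ≣ ((∼ ∼ a) ∧ (∼ ∼ b))
    □-infl : ∀ a → a ≤q (∼ ∼ a)
    □-idem : ∀ a → (∼ ∼ a) ≣ (∼ ∼ (∼ ∼ a))
    qn4c : ∀ a b → (a ≤ b ⇔ ((a ≼ b) × ((∼ b) ≼ (∼ a))))
    qn4d : ∀ a b → (∼ (a ⇒ b)) ≣ (∼ ∼ (a ∧ ∼ b))
    qn4e-1 : ∀ a → a ≤ (∼ ∼ a)
    qn4e-2 : ∀ a → ∼ a ≡ ∼ ∼ ∼ a
    qn4e-3 : ∀ a b → ∼ (a ∨ b) ≡ (∼ a) ∧ (∼ b)
    qn4e-4 : ∀ a b → (∼ ∼ a) ∧ (∼ ∼ b) ≡ ∼ ∼ (a ∧ b)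

record IsAlgStarQN4 {ℓ} (𝔸 : QAlgebra ℓ) : Set ℓ where
  open QAlgebra 𝔸
  field
    ax1  : ∀ α β → E (α ⇒ (β ⇒ α))
    ax2  : ∀ α β γ → E ((α ⇒ (β ⇒ γ)) ⇒ ((α ⇒ β) ⇒ (α ⇒ γ)))
    ax3  : ∀ α β → E ((α ∧ β) ⇒ α)
    ax4  : ∀ α β → E ((α ∧ β) ⇒ β)
    ax5  : ∀ α β γ → E ((α ⇒ β) ⇒ ((α ⇒ γ) ⇒ (α ⇒ (β ∧ γ))))
    ax6  : ∀ α β → E (α ⇒ (α ∨ β))
    ax7  : ∀ α β → E (β ⇒ (α ∨ β))
    ax8  : ∀ α β γ → E ((α ⇒ γ) ⇒ ((β ⇒ γ) ⇒ ((α ∨ β) ⇒ γ)))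
    ax9  : ∀ α β → E ((∼ (α ∨ β)) ⇔' ((∼ α) ∧ (∼ β)))
    ax10 : ∀ α β → E ((∼ (α ⇒ β)) ⇔' (∼ ∼ (α ∧ ∼ β)))
    ax11 : ∀ α β γ → E ((∼ (α ∧ (β ∧ γ))) ⇔' (∼ ((α ∧ β) ∧ γ)))
    ax12 : ∀ α β γ → E ((∼ (α ∧ (β ∨ γ))) ⇔' (∼ ((α ∧ β) ∨ (α ∧ γ))))
    ax13 : ∀ α β γ → E ((∼ (α ∨ (β ∧ γ))) ⇔' (∼ ((α ∨ β) ∧ (α ∨ γ))))
    ax14 : ∀ α β → E ((∼ ∼ (α ∧ β)) ⇔' ((∼ ∼ α) ∧ (∼ ∼ β)))
    ax15 : ∀ α → E (α ⇒ ∼ ∼ α)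
    ax16 : ∀ α → E (α ⇒ ((∼ α) ⇒ (∼ (α ⇒ α))))
    ax17 : ∀ α β → E ((α ⇒ β) ⇒ ((∼ ∼ α) ⇒ (∼ ∼ β)))
    ax18 : ∀ α β → E ((∼ α) ⇒ (∼ (α ∧ β)))
    ax19 : ∀ α β → E ((∼ (α ∧ β)) ⇒ (∼ (β ∧ α)))
    ax20 : ∀ α β → E (((∼ α) ⇒ (∼ β)) ⇒ ((∼ (α ∧ β)) ⇒ (∼ β)))
    ax21 : ∀ α β γ θ → E (((∼ α) ⇒ (∼ β)) ⇒ (((∼ γ) ⇒ (∼ θ)) ⇒ ((∼ (α ∧ γ)) ⇒ (∼ (β ∧ θ)))))
    ax22 : ∀ α → E ((∼ ∼ ∼ α) ⇒ (∼ α))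
    refl-Δ : ∀ α → EΔ α α
    Δ-eq : ∀ α β → EΔ α β → α ≡ β
    mp : ∀ α β → E α → E (α ⇒ β) → E β

-- In both classes E(u) says that [u] is the top of the quotient A/≣, so x ≼ y, i.e.
-- E(x ⇒ y), says [x] ≤ [y]. For a QN4-lattice the axioms then become inequalities of a
-- Brouwerian algebra with the nucleus ∼∼; the one delicate point is that a top element u
-- equals u ⇒ u on the nose, which by QN4c needs ∼u ≣ ∼(u ⇒ u), and QN4d together with
-- QN4e gives ∼(u ⇒ u) ≣ ∼∼u ∧ ∼u ≣ ∼u. Conversely, Ax1–Ax8 make ≼ the provability preorder
-- of positive intuitionistic logic, and the quasi-equation E(Δ(x,y)) ⇒ x ≈ y turns the
-- negation axioms into the lattice laws on the nose; De Morgan (Ax9) reduces those for ∨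
-- to those for ∧.
module Submission where

open import Defs
open import Data.Product using (_,_; proj₁)
open import Function.Bundles using (_⇔_; mk⇔; Equivalence)
open import Relation.Binary.PropositionalEquality
open import Algebra.Consequences.Propositional using (comm∧distrˡ⇒distrʳ)
open import Algebra.Lattice.Bundles using (Lattice)
open import Algebra.Lattice.Properties.Lattice using (∨-∧-orderTheoreticLattice)
open import Algebra.Lattice.Structures.Biased using (isDistributiveLatticeʳʲᵐ)
import Algebra.Lattice.Structures as LS
import Relation.Binary.Lattice as R

module QN4-lattice⇒Alg* {ℓ} {𝔸 : QAlgebra ℓ} (isQN4 : IsQN4Lattice 𝔸) where
  open QAlgebra 𝔸 renaming (_≼_ to infix 4 _≼_; _≣_ to infix 4 _≣_; _≤_ to infix 4 _≤_)
  open IsQN4Lattice isQN4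
  private
    module A = LS.IsDistributiveLattice distributiveLattice
    module Q = LS.IsLattice quotientLattice

  A/≣ : Lattice ℓ ℓ
  A/≣ = record { isLattice = quotientLattice }

  -- the order of A/≣ written on representatives: x ⊑ y iff x ≣ x ∧ y
  open R.Lattice (∨-∧-orderTheoreticLattice A/≣)
    using (x∧y≤x; x∧y≤y; ∧-greatest; x≤x∨y; y≤x∨y; ∨-least; antisym; reflexive)
    renaming (_≤_ to _⊑_; refl to ⊑-refl; trans to ⊑-trans)

  ≤q⇒⊑ : ∀ {x y} → x ≤q y → x ⊑ y
  ≤q⇒⊑ = Q.sym

  ⊑⇒≤q : ∀ {x y} → x ⊑ y → x ≤q y
  ⊑⇒≤q = Q.sym

  ≡⇒⊑ : ∀ {x y} → x ≡ y → x ⊑ y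
  ≡⇒⊑ p = reflexive (Q.reflexive p)

  ≤⇒⊑ : ∀ {x y} → x ≤ y → x ⊑ y
  ≤⇒⊑ x≤y = Q.reflexive (sym x≤y)

  ≤-antisym : ∀ {x y} → x ≤ y → y ≤ x → x ≡ y
  ≤-antisym {x} {y} x≤y y≤x = trans (sym x≤y) (trans (A.∧-comm x y) y≤x)

  ≣-∼≣⇒≡ : ∀ {x y} → x ≣ y → ∼ x ≣ ∼ y → x ≡ y
  ≣-∼≣⇒≡ {x} {y} (x≼y , y≼x) (∼x≼∼y , ∼y≼∼x) =
    ≤-antisym (Equivalence.from (qn4c x y) (x≼y , ∼y≼∼x))
              (Equivalence.from (qn4c y x) (y≼x , ∼x≼∼y))

  curry : ∀ {x y z} → x ∧ y ⊑ z → x ⊑ y ⇒ z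
  curry {x} {y} {z} p = ≤q⇒⊑ (Equivalence.to (residuation x y z) (⊑⇒≤q p))

  uncurry : ∀ {x y z} → x ⊑ y ⇒ z → x ∧ y ⊑ z
  uncurry {x} {y} {z} p = ≤q⇒⊑ (Equivalence.from (residuation x y z) (⊑⇒≤q p))

  modus-ponens : ∀ {x y z} → z ⊑ x ⇒ y → z ⊑ x → z ⊑ y
  modus-ponens z⊑x⇒y z⊑x = ⊑-trans (∧-greatest z⊑x⇒y z⊑x) (uncurry ⊑-refl)

  x∧y⊑x : ∀ {x y} → x ∧ y ⊑ x
  x∧y⊑x = x∧y≤x _ _

  x∧y⊑y : ∀ {x y} → x ∧ y ⊑ y
  x∧y⊑y = x∧y≤y _ _

  x⊑x∨y : ∀ {x y} → x ⊑ x ∨ y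
  x⊑x∨y = x≤x∨y _ _

  y⊑x∨y : ∀ {x y} → y ⊑ x ∨ y
  y⊑x∨y = y≤x∨y _ _

  ⇒-∨-elim : ∀ {x y} → (x ⇒ y) ∧ (x ∨ y) ⊑ y
  ⇒-∨-elim = modus-ponens
    (⊑-trans x∧y⊑y (∨-least (curry (modus-ponens x∧y⊑y x∧y⊑x)) (curry x∧y⊑x))) x∧y⊑x

  ⇒-∨-map : ∀ {x y u v} → ((x ⇒ y) ∧ (u ⇒ v)) ∧ (x ∨ u) ⊑ y ∨ v
  ⇒-∨-map = modus-ponens (⊑-trans x∧y⊑y (∨-least
    (curry (⊑-trans (modus-ponens (⊑-trans x∧y⊑y x∧y⊑x) x∧y⊑x) x⊑x∨y))
    (curry (⊑-trans (modus-ponens (⊑-trans x∧y⊑y x∧y⊑y) x∧y⊑x) y⊑x∨y)))) x∧y⊑x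

  ∼∼-inflationary : ∀ {x} → x ⊑ ∼ ∼ x
  ∼∼-inflationary {x} = ≤q⇒⊑ (□-infl x)

  ∼∼-mono : ∀ {x y} → x ⊑ y → ∼ ∼ x ⊑ ∼ ∼ y
  ∼∼-mono {x} {y} x⊑y = Q.trans (□-welldef x⊑y) (□-∧ x y)

  ∼∼-strength : ∀ {x y z} → x ∧ y ⊑ z → x ∧ ∼ ∼ y ⊑ ∼ ∼ z
  ∼∼-strength {x} {y} x∧y⊑z =
    ⊑-trans (∧-greatest (⊑-trans x∧y⊑x ∼∼-inflationary) x∧y⊑y)
      (⊑-trans (reflexive (Q.sym (□-∧ x y))) (∼∼-mono x∧y⊑z))

  ∼-∧ : ∀ x y → ∼ (x ∧ y) ≡ ∼ ∼ (∼ x ∨ ∼ y)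
  ∼-∧ x y = begin
    ∼ (x ∧ y)              ≡⟨ qn4e-2 (x ∧ y) ⟩
    ∼ ∼ ∼ (x ∧ y)          ≡⟨ cong ∼_ (sym (qn4e-4 x y)) ⟩
    ∼ (∼ ∼ x ∧ ∼ ∼ y)      ≡⟨ cong ∼_ (sym (qn4e-3 (∼ x) (∼ y))) ⟩
    ∼ ∼ (∼ x ∨ ∼ y)        ∎
    where open ≡-Reasoning

  ∼-∧-strength : ∀ {x y z w} → x ∧ (∼ y ∨ ∼ z) ⊑ w → x ∧ ∼ (y ∧ z) ⊑ ∼ ∼ w
  ∼-∧-strength {x} {y} {z} {w} p = subst (λ v → x ∧ v ⊑ ∼ ∼ w) (sym (∼-∧ y z)) (∼∼-strength p)

  IsTop : Carrier → Set ℓ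
  IsTop u = ∀ x → x ⊑ u

  ⇒-top : ∀ {x y} → x ⊑ y → IsTop (x ⇒ y)
  ⇒-top x⊑y z = curry (⊑-trans x∧y⊑y x⊑y)

  top⇒E : ∀ {u} → IsTop u → E u
  top⇒E {u} top = ≣-∼≣⇒≡ u≣∣u∣ ∼u≣∼∣u∣
    where
    u≣∣u∣ : u ≣ ∣ u ∣
    u≣∣u∣ = antisym (⇒-top ⊑-refl u) (top ∣ u ∣)
    ∼∣u∣≣∼∼u∧∼u : ∼ ∣ u ∣ ≣ ∼ ∼ u ∧ ∼ u
    ∼∣u∣≣∼∼u∧∼u = Q.trans (qn4d u u)
      (Q.reflexive (trans (sym (qn4e-4 u (∼ u))) (cong (∼ ∼ u ∧_) (sym (qn4e-2 u)))))
    ∼u≣∼∼u∧∼u : ∼ u ≣ ∼ ∼ u ∧ ∼ u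
    ∼u≣∼∼u∧∼u = antisym (∧-greatest (⊑-trans (top _) ∼∼-inflationary) ⊑-refl) x∧y⊑y
    ∼u≣∼∣u∣ : ∼ u ≣ ∼ ∣ u ∣
    ∼u≣∼∣u∣ = Q.trans ∼u≣∼∼u∧∼u (Q.sym ∼∣u∣≣∼∼u∧∼u)

  E⇒top : ∀ {u} → E u → IsTop u
  E⇒top {u} eu = subst IsTop (sym eu) (⇒-top ⊑-refl)

  ⊑⇒E : ∀ {x y} → x ⊑ y → E (x ⇒ y)
  ⊑⇒E x⊑y = top⇒E (⇒-top x⊑y)

  ≣⇒E⇔ : ∀ {x y} → x ≣ y → E (x ⇔' y)
  ≣⇒E⇔ x≣y = top⇒E (λ z → ∧-greatest (⇒-top (reflexive x≣y) z) (⇒-top (reflexive (Q.sym x≣y)) z))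

  ≡⇒E⇔ : ∀ {x y} → x ≡ y → E (x ⇔' y)
  ≡⇒E⇔ x≡y = ≣⇒E⇔ (Q.reflexive x≡y)

  ∼x≤∼[x∧y] : ∀ x y → ∼ x ≤ ∼ (x ∧ y)
  ∼x≤∼[x∧y] x y = trans (sym (qn4e-3 x (x ∧ y))) (cong ∼_ (A.∨-absorbs-∧ x y))

  isAlg* : IsAlgStarQN4 𝔸
  isAlg* = record
    { ax1  = λ _ _ → ⊑⇒E (curry x∧y⊑x)
    ; ax2  = λ _ _ _ → ⊑⇒E (curry (curry (modus-ponens
               (modus-ponens (⊑-trans x∧y⊑x x∧y⊑x) x∧y⊑y)
               (modus-ponens (⊑-trans x∧y⊑x x∧y⊑y) x∧y⊑y))))
    ; ax3  = λ _ _ → ⊑⇒E x∧y⊑x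
    ; ax4  = λ _ _ → ⊑⇒E x∧y⊑y
    ; ax5  = λ _ _ _ → ⊑⇒E (curry (curry (∧-greatest
               (modus-ponens (⊑-trans x∧y⊑x x∧y⊑x) x∧y⊑y)
               (modus-ponens (⊑-trans x∧y⊑x x∧y⊑y) x∧y⊑y))))
    ; ax6  = λ _ _ → ⊑⇒E x⊑x∨y
    ; ax7  = λ _ _ → ⊑⇒E y⊑x∨y
    ; ax8  = λ _ _ _ → ⊑⇒E (curry (curry (⊑-trans ⇒-∨-map (∨-least ⊑-refl ⊑-refl))))
    ; ax9  = λ a b → ≡⇒E⇔ (qn4e-3 a b)
    ; ax10 = λ a b → ≣⇒E⇔ (qn4d a b)
    ; ax11 = λ a b c → ≡⇒E⇔ (cong ∼_ (sym (A.∧-assoc a b c)))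
    ; ax12 = λ a b c → ≡⇒E⇔ (cong ∼_ (A.∧-distribˡ-∨ a b c))
    ; ax13 = λ a b c → ≡⇒E⇔ (cong ∼_ (A.∨-distribˡ-∧ a b c))
    ; ax14 = λ a b → ≡⇒E⇔ (sym (qn4e-4 a b))
    ; ax15 = λ _ → ⊑⇒E ∼∼-inflationary
    ; ax16 = λ a → ⊑⇒E (curry (⊑-trans ∼∼-inflationary (reflexive (Q.sym (qn4d a a)))))
    ; ax17 = λ _ _ → ⊑⇒E (curry (∼∼-strength (uncurry ⊑-refl)))
    ; ax18 = λ a b → ⊑⇒E (≤⇒⊑ (∼x≤∼[x∧y] a b))
    ; ax19 = λ a b → ⊑⇒E (≡⇒⊑ (cong ∼_ (A.∧-comm a b)))
    ; ax20 = λ _ b → ⊑⇒E (curry (⊑-trans (∼-∧-strength ⇒-∨-elim) (≡⇒⊑ (sym (qn4e-2 b)))))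
    ; ax21 = λ _ b _ d → ⊑⇒E (curry (curry (⊑-trans (∼-∧-strength ⇒-∨-map) (≡⇒⊑ (sym (∼-∧ b d))))))
    ; ax22 = λ a → ⊑⇒E (≡⇒⊑ (sym (qn4e-2 a)))
    ; refl-Δ = λ _ → ⊑⇒E ⊑-refl , ⊑⇒E ⊑-refl , ⊑⇒E ⊑-refl , ⊑⇒E ⊑-refl
    ; Δ-eq = λ _ _ (x≼y , y≼x , ∼x≼∼y , ∼y≼∼x) → ≣-∼≣⇒≡ (x≼y , y≼x) (∼x≼∼y , ∼y≼∼x)
    ; mp = λ _ _ ex ex⇒y → top⇒E (λ z → modus-ponens (E⇒top ex⇒y z) (E⇒top ex z))
    }

module Alg*⇒QN4-lattice {ℓ} {𝔸 : QAlgebra ℓ} (isAlg* : IsAlgStarQN4 𝔸) where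
  open QAlgebra 𝔸 renaming (_≼_ to infix 4 _≼_; _≣_ to infix 4 _≣_; _≤_ to infix 4 _≤_)
  open IsAlgStarQN4 isAlg*

  -- x ≼ y unfolds definitionally to E (x ⇒ y), the form in which the axioms are stated.
  ≼-refl : ∀ {x} → x ≼ x
  ≼-refl {x} = proj₁ (refl-Δ x)

  weaken : ∀ {x y} → E y → x ≼ y
  weaken {x} {y} ey = mp _ _ ey (ax1 y x)

  mp-under : ∀ {x y z} → z ≼ x ⇒ y → z ≼ x → z ≼ y
  mp-under {x} {y} {z} z≼x⇒y z≼x = mp _ _ z≼x (mp _ _ z≼x⇒y (ax2 z x y))

  ≼-trans : ∀ {x y z} → x ≼ y → y ≼ z → x ≼ z
  ≼-trans x≼y y≼z = mp-under (weaken y≼z) x≼y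

  x∧y≼x : ∀ {x y} → x ∧ y ≼ x
  x∧y≼x = ax3 _ _

  x∧y≼y : ∀ {x y} → x ∧ y ≼ y
  x∧y≼y = ax4 _ _

  x≼x∨y : ∀ {x y} → x ≼ x ∨ y
  x≼x∨y = ax6 _ _

  y≼x∨y : ∀ {x y} → y ≼ x ∨ y
  y≼x∨y = ax7 _ _

  ∧-greatest : ∀ {x y z} → x ≼ y → x ≼ z → x ≼ y ∧ z
  ∧-greatest {x} {y} {z} x≼y x≼z = mp _ _ x≼z (mp _ _ x≼y (ax5 x y z))

  ∨-least : ∀ {x y z} → x ≼ z → y ≼ z → x ∨ y ≼ z
  ∨-least {x} {y} {z} x≼z y≼z = mp _ _ y≼z (mp _ _ x≼z (ax8 x y z))

  ⇔'⇒≼ : ∀ {x y} → E (x ⇔' y) → x ≼ y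
  ⇔'⇒≼ h = mp _ _ h x∧y≼x

  ⇔'⇒≽ : ∀ {x y} → E (x ⇔' y) → y ≼ x
  ⇔'⇒≽ h = mp _ _ h x∧y≼y

  ∧-swap : ∀ {x y} → x ∧ y ≼ y ∧ x
  ∧-swap = ∧-greatest x∧y≼y x∧y≼x

  uncurry : ∀ {x y z} → x ≼ y ⇒ z → x ∧ y ≼ z
  uncurry x≼y⇒z = mp-under (≼-trans x∧y≼x x≼y⇒z) x∧y≼y

  curry : ∀ {x y z} → x ∧ y ≼ z → x ≼ y ⇒ z
  curry {x} {y} {z} x∧y≼z = ≼-trans pair (mp _ _ (weaken x∧y≼z) (ax2 y (x ∧ y) z))
    where
    pair : x ≼ y ⇒ x ∧ y
    pair = mp-under (mp-under (weaken (ax5 y x y)) (ax1 x y)) (weaken ≼-refl)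

  ∧-mono : ∀ {x y u v} → x ≼ y → u ≼ v → x ∧ u ≼ y ∧ v
  ∧-mono x≼y u≼v = ∧-greatest (≼-trans x∧y≼x x≼y) (≼-trans x∧y≼y u≼v)

  ∨-mono : ∀ {x y u v} → x ≼ y → u ≼ v → x ∨ u ≼ y ∨ v
  ∨-mono x≼y u≼v = ∨-least (≼-trans x≼y x≼x∨y) (≼-trans u≼v y≼x∨y)

  ⇒-mono : ∀ {x y u v} → y ≼ x → u ≼ v → x ⇒ u ≼ y ⇒ v
  ⇒-mono y≼x u≼v = curry (mp-under (≼-trans x∧y≼x (weaken u≼v))
                                  (mp-under x∧y≼x (≼-trans x∧y≼y y≼x)))

  ∼∼-mono : ∀ {x y} → x ≼ y → ∼ ∼ x ≼ ∼ ∼ y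
  ∼∼-mono {x} {y} x≼y = mp _ _ x≼y (ax17 x y)

  ∼-∧-mono : ∀ {x y u v} → ∼ x ≼ ∼ y → ∼ u ≼ ∼ v → ∼ (x ∧ u) ≼ ∼ (y ∧ v)
  ∼-∧-mono {x} {y} {u} {v} p q = mp _ _ q (mp _ _ p (ax21 x y u v))

  ∼y≼∼[x∧y] : ∀ {x y} → ∼ y ≼ ∼ (x ∧ y)
  ∼y≼∼[x∧y] {x} {y} = ≼-trans (ax18 y x) (ax19 y x)

  ∼[x∧x]≼∼x : ∀ {x} → ∼ (x ∧ x) ≼ ∼ x
  ∼[x∧x]≼∼x {x} = mp _ _ ≼-refl (ax20 x x)

  Δ-antisym : ∀ {x y} → x ≼ y → y ≼ x → ∼ x ≼ ∼ y → ∼ y ≼ ∼ x → x ≡ y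
  Δ-antisym {x} {y} x≼y y≼x ∼x≼∼y ∼y≼∼x = Δ-eq x y (x≼y , y≼x , ∼x≼∼y , ∼y≼∼x)

  ≼-antisym-∼≡ : ∀ {x y} → x ≼ y → y ≼ x → ∼ x ≡ ∼ y → x ≡ y
  ≼-antisym-∼≡ {x} x≼y y≼x ∼x≡∼y =
    Δ-antisym x≼y y≼x (subst (∼ x ≼_) ∼x≡∼y ≼-refl) (subst (_≼ ∼ x) ∼x≡∼y ≼-refl)

  ≤⇒≼ : ∀ {x y} → x ≤ y → x ≼ y
  ≤⇒≼ {x} {y} x≤y = subst (_≼ y) x≤y x∧y≼y

  ≤⇒∼≽∼ : ∀ {x y} → x ≤ y → ∼ y ≼ ∼ x
  ≤⇒∼≽∼ {x} {y} x≤y = subst (λ z → ∼ y ≼ ∼ z) x≤y ∼y≼∼[x∧y]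

  ≼-∼≽⇒≤ : ∀ {x y} → x ≼ y → ∼ y ≼ ∼ x → x ≤ y
  ≼-∼≽⇒≤ {x} {y} x≼y ∼y≼∼x =
    Δ-antisym x∧y≼x (∧-greatest ≼-refl x≼y) (≼-trans (ax19 x y) (mp _ _ ∼y≼∼x (ax20 y x))) (ax18 x y)

  ∧-comm : ∀ x y → x ∧ y ≡ y ∧ x
  ∧-comm x y = Δ-antisym ∧-swap ∧-swap (ax19 x y) (ax19 y x)

  ∧-assoc : ∀ x y z → (x ∧ y) ∧ z ≡ x ∧ (y ∧ z)
  ∧-assoc x y z =
    Δ-antisym (∧-greatest (≼-trans x∧y≼x x∧y≼x) (∧-mono x∧y≼y ≼-refl))
              (∧-greatest (∧-mono ≼-refl x∧y≼x) (≼-trans x∧y≼y x∧y≼y))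
              (⇔'⇒≽ (ax11 x y z)) (⇔'⇒≼ (ax11 x y z))

  ∼x≡∼∼∼x : ∀ x → ∼ x ≡ ∼ ∼ ∼ x
  ∼x≡∼∼∼x x = Δ-antisym (ax15 (∼ x)) (ax22 x) (ax15 (∼ ∼ x)) (ax22 (∼ x))

  ∼-∨ : ∀ x y → ∼ (x ∨ y) ≡ ∼ x ∧ ∼ y
  ∼-∨ x y = Δ-antisym (⇔'⇒≼ (ax9 x y)) (⇔'⇒≽ (ax9 x y)) ∼∼[x∨y]≼∼[∼x∧∼y] ∼[∼x∧∼y]≼∼∼[x∨y]
    where
    ∼∼[x∨y]≼∼[∼x∧∼y] : ∼ ∼ (x ∨ y) ≼ ∼ (∼ x ∧ ∼ y)
    ∼∼[x∨y]≼∼[∼x∧∼y] = ≼-trans (∼∼-mono (∨-least (≼-trans (ax15 x) (ax18 (∼ x) (∼ y)))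
                                                  (≼-trans (ax15 y) ∼y≼∼[x∧y])))
                               (ax22 _)
    ∼[∼x∧∼y]≼∼∼[x∨y] : ∼ (∼ x ∧ ∼ y) ≼ ∼ ∼ (x ∨ y)
    ∼[∼x∧∼y]≼∼∼[x∨y] = ≼-trans (∼-∧-mono (∼∼-mono x≼x∨y) (∼∼-mono y≼x∨y)) ∼[x∧x]≼∼x

  ∼∼-∧ : ∀ x y → ∼ ∼ x ∧ ∼ ∼ y ≡ ∼ ∼ (x ∧ y)
  ∼∼-∧ x y = Δ-antisym (⇔'⇒≽ (ax14 x y)) (⇔'⇒≼ (ax14 x y))
    (≼-trans (∼-∧-mono (ax22 x) (ax22 y)) (ax15 _))
    (≼-trans (ax22 _) (∼-∧-mono (ax15 (∼ x)) (ax15 (∼ y))))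

  ∨-comm : ∀ x y → x ∨ y ≡ y ∨ x
  ∨-comm x y = ≼-antisym-∼≡ (∨-least y≼x∨y x≼x∨y) (∨-least y≼x∨y x≼x∨y) (begin
    ∼ (x ∨ y)    ≡⟨ ∼-∨ x y ⟩
    ∼ x ∧ ∼ y    ≡⟨ ∧-comm (∼ x) (∼ y) ⟩
    ∼ y ∧ ∼ x    ≡⟨ ∼-∨ y x ⟨
    ∼ (y ∨ x)    ∎)
    where open ≡-Reasoning

  ∨-assoc : ∀ x y z → (x ∨ y) ∨ z ≡ x ∨ (y ∨ z)
  ∨-assoc x y z =
    ≼-antisym-∼≡ (∨-least (∨-mono ≼-refl x≼x∨y) (≼-trans y≼x∨y y≼x∨y))
                 (∨-least (≼-trans x≼x∨y x≼x∨y) (∨-mono y≼x∨y ≼-refl)) (begin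
      ∼ ((x ∨ y) ∨ z)      ≡⟨ ∼-∨ (x ∨ y) z ⟩
      ∼ (x ∨ y) ∧ ∼ z      ≡⟨ cong (_∧ ∼ z) (∼-∨ x y) ⟩
      (∼ x ∧ ∼ y) ∧ ∼ z    ≡⟨ ∧-assoc (∼ x) (∼ y) (∼ z) ⟩
      ∼ x ∧ (∼ y ∧ ∼ z)    ≡⟨ cong (∼ x ∧_) (∼-∨ y z) ⟨
      ∼ x ∧ ∼ (y ∨ z)      ≡⟨ ∼-∨ x (y ∨ z) ⟨
      ∼ (x ∨ (y ∨ z))      ∎)
    where open ≡-Reasoning

  ∨-absorbs-∧ : ∀ x y → x ∨ (x ∧ y) ≡ x
  ∨-absorbs-∧ x y = ≼-antisym-∼≡ (∨-least ≼-refl x∧y≼x) x≼x∨y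
    (trans (∼-∨ x (x ∧ y)) (≼-∼≽⇒≤ (ax18 x y) (∼∼-mono x∧y≼x)))

  ∧-absorbs-∨ : ∀ x y → x ∧ (x ∨ y) ≡ x
  ∧-absorbs-∨ x y = ≼-∼≽⇒≤ x≼x∨y (≼-trans (⇔'⇒≼ (ax9 x y)) x∧y≼x)

  ∧-distribˡ-∨-≼ : ∀ {x y z} → x ∧ (y ∨ z) ≼ (x ∧ y) ∨ (x ∧ z)
  ∧-distribˡ-∨-≼ = ≼-trans ∧-swap
    (uncurry (∨-least (curry (≼-trans ∧-swap x≼x∨y)) (curry (≼-trans ∧-swap y≼x∨y))))

  ∨-distribˡ-∧ : ∀ x y z → x ∨ (y ∧ z) ≡ (x ∨ y) ∧ (x ∨ z)
  ∨-distribˡ-∧ x y z = Δ-antisym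
    (∨-least (∧-greatest x≼x∨y x≼x∨y) (∧-mono y≼x∨y y≼x∨y))
    (uncurry (∨-least (≼-trans x≼x∨y (ax1 _ _))
                      (curry (≼-trans ∧-distribˡ-∨-≼ (∨-least (≼-trans x∧y≼y x≼x∨y) y≼x∨y)))))
    (⇔'⇒≼ (ax13 x y z)) (⇔'⇒≽ (ax13 x y z))

  isLattice : LS.IsLattice _≡_ _∨_ _∧_
  isLattice = record
    { isEquivalence = isEquivalence
    ; ∨-comm        = ∨-comm
    ; ∨-assoc       = ∨-assoc
    ; ∨-cong        = cong₂ _∨_
    ; ∧-comm        = ∧-comm
    ; ∧-assoc       = ∧-assoc
    ; ∧-cong        = cong₂ _∧_
    ; absorptive    = ∨-absorbs-∧ , ∧-absorbs-∨
    }

  isDistributiveLattice : LS.IsDistributiveLattice _≡_ _∨_ _∧_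
  isDistributiveLattice = isDistributiveLatticeʳʲᵐ record
    { isLattice    = isLattice
    ; ∨-distribʳ-∧ = comm∧distrˡ⇒distrʳ ∨-comm ∨-distribˡ-∧
    }

  ≡⇒≣ : ∀ {x y} → x ≡ y → x ≣ y
  ≡⇒≣ refl = ≼-refl , ≼-refl

  isQuotientLattice : LS.IsLattice _≣_ _∨_ _∧_
  isQuotientLattice = record
    { isEquivalence = record
        { refl  = ≼-refl , ≼-refl
        ; sym   = λ (x≼y , y≼x) → y≼x , x≼y
        ; trans = λ (x≼y , y≼x) (y≼z , z≼y) → ≼-trans x≼y y≼z , ≼-trans z≼y y≼x
        }
    ; ∨-comm     = λ x y → ≡⇒≣ (∨-comm x y)
    ; ∨-assoc    = λ x y z → ≡⇒≣ (∨-assoc x y z)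
    ; ∨-cong     = λ (x≼y , y≼x) (u≼v , v≼u) → ∨-mono x≼y u≼v , ∨-mono y≼x v≼u
    ; ∧-comm     = λ x y → ≡⇒≣ (∧-comm x y)
    ; ∧-assoc    = λ x y z → ≡⇒≣ (∧-assoc x y z)
    ; ∧-cong     = λ (x≼y , y≼x) (u≼v , v≼u) → ∧-mono x≼y u≼v , ∧-mono y≼x v≼u
    ; absorptive = (λ x y → ≡⇒≣ (∨-absorbs-∧ x y)) , (λ x y → ≡⇒≣ (∧-absorbs-∨ x y))
    }

  ≼⇒≤q : ∀ {x y} → x ≼ y → x ≤q y
  ≼⇒≤q x≼y = x∧y≼x , ∧-greatest ≼-refl x≼y

  ≤q⇒≼ : ∀ {x y} → x ≤q y → x ≼ y
  ≤q⇒≼ (_ , x≼x∧y) = ≼-trans x≼x∧y x∧y≼y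

  isQN4 : IsQN4Lattice 𝔸
  isQN4 = record
    { distributiveLattice = isDistributiveLattice
    ; quotientLattice     = isQuotientLattice
    ; ⇒-cong      = λ (x≼y , y≼x) (u≼v , v≼u) → ⇒-mono y≼x u≼v , ⇒-mono x≼y v≼u
    ; residuation = λ _ _ _ → mk⇔ (λ p → ≼⇒≤q (curry (≤q⇒≼ p))) (λ p → ≼⇒≤q (uncurry (≤q⇒≼ p)))
    ; □-welldef   = λ (x≼y , y≼x) → ∼∼-mono x≼y , ∼∼-mono y≼x
    ; □-∧         = λ x y → ⇔'⇒≼ (ax14 x y) , ⇔'⇒≽ (ax14 x y)
    ; □-infl      = λ x → ≼⇒≤q (ax15 x)
    ; □-idem      = λ x → ax15 (∼ ∼ x) , ax22 (∼ x)
    ; qn4c        = λ _ _ → mk⇔ (λ x≤y → ≤⇒≼ x≤y , ≤⇒∼≽∼ x≤y) (λ (x≼y , ∼y≼∼x) → ≼-∼≽⇒≤ x≼y ∼y≼∼x)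
    ; qn4d        = λ x y → ⇔'⇒≼ (ax10 x y) , ⇔'⇒≽ (ax10 x y)
    ; qn4e-1      = λ x → ≼-∼≽⇒≤ (ax15 x) (ax22 x)
    ; qn4e-2      = ∼x≡∼∼∼x
    ; qn4e-3      = ∼-∨
    ; qn4e-4      = ∼∼-∧
    }

corollary1 : ∀ {ℓ} (𝔸 : QAlgebra ℓ) → IsQN4Lattice 𝔸 ⇔ IsAlgStarQN4 𝔸
corollary1 𝔸 = mk⇔ QN4-lattice⇒Alg*.isAlg* Alg*⇒QN4-lattice.isQN4
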